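{- Let $n\ge 1$, $X\subseteq B^n$, and let $G=Q_n(X)$ be a daisy cube. Then every $\Theta$-class $E$ of $G$ is peripheral, i.e. for an edge $ab\in E$ at least one of $U_{ab}=W_{ab}$ or $U_{ba}=W_{ba}$ holds.
   Context: $B=\{0,1\}$; $B^n$ is the set of binary strings of length $n$. The $n$-cube $Q_n$ has vertex set $B^n$, two strings adjacent iff they differ in exactly one position. For $u=u_1\dots u_n$, $v=v_1\dots v_n$ write $u\le v$ if $u_i\le v_i$ for all $i$. For $X\subseteq B^n$, the daisy cube $Q_n(X)$ is the subgraph of $Q_n$ induced by $\{u\in B^n : u\le x \text{ for some } x\in X\}$. For a connected graph $G$ with distance $d$, edges $xy$ and $uv$ are in relation $\Theta$ if $d(x,u)+d(y,v)\neq d(x,v)+d(y,u)$; a $\Theta$-class is an equivalence class of the transitive closure of $\Theta$. For an edge $ab$: $W_{ab}=\{w\in V(G): d(a,w)<d(b,w)\}$, $W_{ba}=\{w: d(b,w)<d(a,w)\}$, $F_{ab}=\{xy\in E(G): x\in W_{ab}, y\in W_{ba}\}$, $U_{ab}$ = set of vertices of $W_{ab}$ that are endpoints of edges in $F_{ab}$, $U_{ba}$ = set of vertices of $W_{ba}$ that are endpoints of edges in $F_{ab}$. -}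

module Defs where

open import Data.Bool using (Bool) renaming (_≤_ to _≤ᵇ_)
open import Data.Nat using (ℕ; zero; suc; _<_; _≤_)
open import Data.Fin using (Fin)
open import Data.Vec using (Vec; lookup)
open import Data.List using (List)
open import Data.List.Membership.Propositional using (_∈_)
open import Data.Product using (Σ; ∃; _×_; ∃-syntax)
open import Relation.Binary.PropositionalEquality using (_≡_)
open import Relation.Nullary using (¬_)

Bⁿ : ℕ → Set
Bⁿ n = Vec Bool n

_≼_ : ∀ {n} → Bⁿ n → Bⁿ n → Set
_≼_ {n} u v = ∀ (i : Fin n) → lookup u i ≤ᵇ lookup v i

AdjQ : ∀ {n} → Bⁿ n → Bⁿ n → Set
AdjQ {n} u v = ∃[ i ] (¬ (lookup u i ≡ lookup v i)
                       × (∀ (j : Fin n) → ¬ (j ≡ i) → lookup u j ≡ lookup v j))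

V : ∀ {n} → List (Bⁿ n) → Bⁿ n → Set
V X u = ∃[ x ] (x ∈ X × u ≼ x)

E : ∀ {n} → List (Bⁿ n) → Bⁿ n → Bⁿ n → Set
E X u v = V X u × V X v × AdjQ u v

data Walk {n} (X : List (Bⁿ n)) : Bⁿ n → Bⁿ n → ℕ → Set where
  here  : ∀ {u} → V X u → Walk X u u zero
  step  : ∀ {u w v k} → E X u w → Walk X w v k → Walk X u v (suc k)

Dist : ∀ {n} → List (Bⁿ n) → Bⁿ n → Bⁿ n → ℕ → Set
Dist X u v k = Walk X u v k × (∀ m → Walk X u v m → k ≤ m)

W : ∀ {n} → List (Bⁿ n) → Bⁿ n → Bⁿ n → Bⁿ n → Set
W X a b w = V X w × ∃[ k ] ∃[ l ] (Dist X a w k × Dist X b w l × k < l)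

U : ∀ {n} → List (Bⁿ n) → Bⁿ n → Bⁿ n → Bⁿ n → Set
U X a b w = W X a b w × ∃[ y ] (E X w y × W X b a y)

module Submission where

-- Let ab be an edge of G; a and b differ in exactly one coordinate i, and
-- (swapping a and b if needed) aᵢ = 1, bᵢ = 0.  The map clear : u ↦ u[i ≔ 0]
-- sends vertices of G to vertices of G (daisy cubes are down-closed), maps an
-- edge to an edge or collapses it (when the edge flips coordinate i), and
-- clear a = b.  Hence every walk of length m from u to v shadows to a walk of
-- length ≤ m from clear u to clear v, of length ≤ m - 1 if uᵢ ≠ vᵢ.
--
-- Now take w ∈ W_ab, with k = d(a,w) < d(b,w).  If wᵢ = 0, the shadow of a
-- shortest a–w walk is a b–w walk of length ≤ k, impossible; so wᵢ = 1.  Then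
-- y = clear w is a neighbour of w with d(b,y) = k and d(a,y) = k + 1, so
-- y ∈ W_ba and w ∈ U_ab.  Thus W_ab = U_ab.

open import Defs
open import Data.Nat using (ℕ; _≤_; suc; z≤n; s≤s)
open import Data.Nat.Properties using (≤-trans; ≤-antisym; ≤-pred; <⇒≱; m≤n⇒m≤1+n; n<1+n; <⇒≤)
open import Data.Bool using (Bool; true; false)
open import Data.Bool.Properties using (≤-minimum; ≤-refl) renaming (≤-trans to ≤ᵇ-trans; _≟_ to _≟ᵇ_)
open import Data.Fin using (Fin; _≟_)
open import Data.Vec using (lookup; _[_]≔_)
open import Data.Vec.Properties using (lookup∘update; lookup∘update′; []≔-lookup)
open import Data.Vec.Relation.Binary.Pointwise.Extensional using (ext; Pointwise-≡⇒≡)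
open import Data.List using (List)
open import Data.Product using (_×_; _,_; proj₁; proj₂; ∃-syntax)
open import Data.Sum using (_⊎_; inj₁; inj₂)
open import Data.Empty using (⊥-elim)
open import Function.Bundles using (_⇔_; mk⇔)
open import Relation.Binary.PropositionalEquality using (_≡_; _≢_; refl; sym; trans; subst)
open import Relation.Nullary using (yes; no)

distinct-bools : ∀ {x y : Bool} → x ≢ y → (x ≡ true × y ≡ false) ⊎ (x ≡ false × y ≡ true)
distinct-bools {true}  {true}  x≢y = ⊥-elim (x≢y refl)
distinct-bools {true}  {false} _   = inj₁ (refl , refl)
distinct-bools {false} {true}  _   = inj₂ (refl , refl)
distinct-bools {false} {false} x≢y = ⊥-elim (x≢y refl)

one≢zero : ∀ {x y : Bool} → x ≡ true → y ≡ false → x ≢ y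
one≢zero refl refl ()

module _ {n : ℕ} {X : List (Bⁿ n)} where

  E-sym : ∀ {u v} → E X u v → E X v u
  E-sym (Vu , Vv , j , uⱼ≢vⱼ , agree) =
    Vv , Vu , j , (λ eq → uⱼ≢vⱼ (sym eq)) , λ k k≢j → sym (agree k k≢j)

  snoc : ∀ {u v z m} → Walk X u v m → E X v z → Walk X u z (suc m)
  snoc (here _)     e = step e (here (proj₁ (proj₂ e)))
  snoc (step e′ walk) e = step e′ (snoc walk e)

  dist-via-edge : ∀ {s w y l} → Dist X s w l → E X y w →
                  ∀ m → Walk X s y m → l ≤ suc m
  dist-via-edge (_ , shortest) y~w m walk = shortest (suc m) (snoc walk y~w)

module Clear {n : ℕ} (X : List (Bⁿ n)) (i : Fin n) where

  clear : Bⁿ n → Bⁿ n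
  clear u = u [ i ]≔ false

  clear-at : ∀ u → lookup (clear u) i ≡ false
  clear-at u = lookup∘update i u false

  clear-off : ∀ u {k} → k ≢ i → lookup (clear u) k ≡ lookup u k
  clear-off u k≢i = lookup∘update′ k≢i u false

  clear-fixed : ∀ {u} → lookup u i ≡ false → clear u ≡ u
  clear-fixed {u} uᵢ≡0 = subst (λ b → u [ i ]≔ b ≡ u) uᵢ≡0 ([]≔-lookup u i)

  clear-agree : ∀ {u w} → (∀ k → k ≢ i → lookup u k ≡ lookup w k) → clear u ≡ clear w
  clear-agree {u} {w} agree = Pointwise-≡⇒≡ (ext pointwise)
    where
    pointwise : ∀ k → lookup (clear u) k ≡ lookup (clear w) k
    pointwise k with k ≟ i
    ... | yes refl = trans (clear-at u) (sym (clear-at w))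
    ... | no k≢i   = trans (clear-off u k≢i) (trans (agree k k≢i) (sym (clear-off w k≢i)))

  -- Since Q_n(X) is down-closed, clear maps vertices of G to vertices of G.
  clear-V : ∀ {u} → V X u → V X (clear u)
  clear-V {u} (x , x∈X , u≼x) = x , x∈X , λ k → ≤ᵇ-trans (clear-≼ k) (u≼x k)
    where
    clear-≼ : clear u ≼ u
    clear-≼ k with k ≟ i
    ... | yes refl rewrite clear-at u = ≤-minimum (lookup u i)
    ... | no k≢i   rewrite clear-off u k≢i = ≤-refl

  flip-agree : ∀ {u w} → AdjQ u w → lookup u i ≢ lookup w i →
               ∀ k → k ≢ i → lookup u k ≡ lookup w k
  flip-agree (j , _ , agree) uᵢ≢wᵢ k k≢i with k ≟ j | i ≟ j
  ... | no k≢j   | _        = agree k k≢j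
  ... | yes refl | yes refl = ⊥-elim (k≢i refl)
  ... | yes refl | no i≢j   = ⊥-elim (uᵢ≢wᵢ (agree i i≢j))

  clear-adj : ∀ {u w} → lookup u i ≡ lookup w i → AdjQ u w → AdjQ (clear u) (clear w)
  clear-adj {u} {w} uᵢ≡wᵢ (j , uⱼ≢wⱼ , agree) with j ≟ i
  ... | yes refl = ⊥-elim (uⱼ≢wⱼ uᵢ≡wᵢ)
  ... | no j≢i   =
    j , (λ eq → uⱼ≢wⱼ (trans (sym (clear-off u j≢i)) (trans eq (clear-off w j≢i)))) , agree′
    where
    agree′ : ∀ k → k ≢ j → lookup (clear u) k ≡ lookup (clear w) k
    agree′ k k≢j with k ≟ i
    ... | yes refl = trans (clear-at u) (sym (clear-at w))
    ... | no k≢i   = trans (clear-off u k≢i) (trans (agree k k≢j) (sym (clear-off w k≢i)))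

  record Shadow (u v : Bⁿ n) (m : ℕ) : Set where
    field
      length  : ℕ
      walk    : Walk X (clear u) (clear v) length
      shorter : length ≤ m
      strict  : lookup u i ≢ lookup v i → suc length ≤ m

  shadow : ∀ {u v m} → Walk X u v m → Shadow u v m
  shadow {u} (here Vu) = record
    { length = 0 ; walk = here (clear-V {u} Vu) ; shorter = z≤n ; strict = λ uᵢ≢uᵢ → ⊥-elim (uᵢ≢uᵢ refl) }
  shadow {u} (step {w = w} (Vu , Vw , u~w) rest) with shadow rest | lookup u i ≟ᵇ lookup w i
  ... | sh | yes uᵢ≡wᵢ = record
    { length  = suc length
    ; walk    = step (clear-V {u} Vu , clear-V {w} Vw , clear-adj {u} {w} uᵢ≡wᵢ u~w) walk
    ; shorter = s≤s shorter
    ; strict  = λ uᵢ≢vᵢ → s≤s (strict (λ wᵢ≡vᵢ → uᵢ≢vᵢ (trans uᵢ≡wᵢ wᵢ≡vᵢ)))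
    }
    where open Shadow sh
  ... | sh | no uᵢ≢wᵢ = record
    { length  = length
    ; walk    = subst (λ z → Walk X z _ length) (sym (clear-agree {u} {w} (flip-agree {u} {w} u~w uᵢ≢wᵢ))) walk
    ; shorter = m≤n⇒m≤1+n shorter
    ; strict  = λ _ → s≤s shorter
    }
    where open Shadow sh

module Peripheral {n : ℕ} (X : List (Bⁿ n)) (i : Fin n) {t s : Bⁿ n}
                  (t~s : E X t s) (tᵢ≡1 : lookup t i ≡ true) (sᵢ≡0 : lookup s i ≡ false) where
  open Clear X i

  clear-t : clear t ≡ s
  clear-t = trans (clear-agree {t} {s} (flip-agree {t} {s} (proj₂ (proj₂ t~s)) (one≢zero tᵢ≡1 sᵢ≡0)))
                  (clear-fixed sᵢ≡0)

  from-s : ∀ {v m} (walk : Walk X t v m) → Walk X s (clear v) (Shadow.length (shadow walk))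
  from-s walk = subst (λ z → Walk X z _ _) clear-t (Shadow.walk (shadow walk))

  closer-to-s : ∀ {v m} → Walk X t v m → lookup v i ≡ false → ∃[ p ] (Walk X s v p × suc p ≤ m)
  closer-to-s walk vᵢ≡0 =
    Shadow.length sh , subst (λ z → Walk X s z (Shadow.length sh)) (clear-fixed vᵢ≡0) (from-s walk) ,
    Shadow.strict sh (one≢zero tᵢ≡1 vᵢ≡0)
    where sh = shadow walk

  W-top : ∀ {w} → W X t s w → lookup w i ≡ true
  W-top {w} (_ , k , l , (t⇝w , _) , (_ , s-shortest) , k<l) with lookup w i in wᵢ
  ... | true  = refl
  ... | false with closer-to-s t⇝w wᵢ
  ...   | p , s⇝w , p<k = ⊥-elim (<⇒≱ k<l (≤-trans (s-shortest p s⇝w) (<⇒≤ p<k)))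

  -- W_ts ⊆ U_ts: the neighbour y = clear w of w lies in W_st,
  -- since d(s,y) = d(t,w) = k and d(t,y) = k + 1.
  W⊆U : ∀ w → W X t s w → U X t s w
  W⊆U w w∈W@(Vw , k , l , (t⇝w , _) , s-dist , k<l) =
    w∈W , y , w~y , (clear-V {w} Vw , k , suc k , (s⇝y , s-shortest) , (step t~s s⇝y , t-shortest) , n<1+n k)
    where
    y : Bⁿ n
    y = clear w

    w~y : E X w y
    w~y = Vw , clear-V {w} Vw , i , one≢zero (W-top w∈W) (clear-at w) , λ j j≢i → sym (clear-off w j≢i)

    s-shortest : ∀ m → Walk X s y m → k ≤ m
    s-shortest m s⇝y = ≤-pred (≤-trans k<l (dist-via-edge s-dist (E-sym {u = w} {v = y} w~y) m s⇝y))

    s⇝y : Walk X s y k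
    s⇝y = subst (Walk X s y) (≤-antisym (Shadow.shorter (shadow t⇝w)) (s-shortest _ (from-s t⇝w)))
                (from-s t⇝w)

    t-shortest : ∀ m → Walk X t y m → suc k ≤ m
    t-shortest m t⇝y with closer-to-s t⇝y (clear-at w)
    ... | p , s⇝y′ , p<m = ≤-trans (s≤s (s-shortest p s⇝y′)) p<m

proposition2p1 : (n : ℕ) → 1 ≤ n → (X : List (Bⁿ n)) →
    ∀ a b → E X a b →
      (∀ w → W X a b w ⇔ U X a b w) ⊎ (∀ w → W X b a w ⇔ U X b a w)
proposition2p1 n _ X a b a~b@(_ , _ , i , aᵢ≢bᵢ , _) with distinct-bools aᵢ≢bᵢ
... | inj₁ (aᵢ≡1 , bᵢ≡0) = inj₁ λ w → mk⇔ (Peripheral.W⊆U X i a~b aᵢ≡1 bᵢ≡0 w) proj₁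
... | inj₂ (aᵢ≡0 , bᵢ≡1) = inj₂ λ w → mk⇔ (Peripheral.W⊆U X i (E-sym {u = a} {v = b} a~b) bᵢ≡1 aᵢ≡0 w) proj₁
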